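{- Let $G$ be a graph with $n_1$ vertices and maximum degree $\Delta$, and let $H$ be a graph with $n_2$ vertices. Then $$(n_2+1)\Delta+1\le \chi_{\le 2}(G\diamond H)\le n_1(n_2+1).$$
   Context: For a simple graph $G$ with edges $e_1,\dots,e_m$ and a graph $H$, the edge corona product $G\diamond H$ is the graph obtained by taking one copy of $G$ and $m$ vertex-disjoint copies $H_1,\dots,H_m$ of $H$ and joining both end vertices of $e_i$ to every vertex of $H_i$, $1\le i\le m$. A $k$-distance coloring of a graph is a vertex coloring in which any two distinct vertices at distance at most $k$ receive different colors; $\chi_{\le k}$ denotes the minimum number of colors in a $k$-distance coloring. -}

module Defs where

open import Data.Nat using (ℕ; zero; suc; _+_; _*_; _≤_; _<_; _⊔_)
open import Data.Fin using (Fin; toℕ)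
open import Data.Bool using (Bool; true; false; if_then_else_; T)
open import Data.List using (List; map; foldr; allFin)
open import Data.Nat.ListAction using (sum)
open import Data.Product using (Σ; _×_; _,_; proj₁; proj₂)
open import Data.Sum using (_⊎_; inj₁; inj₂)
open import Relation.Binary.PropositionalEquality using (_≡_; _≢_)

record Graph (n : ℕ) : Set where
  field
    adj    : Fin n → Fin n → Bool
    sym    : ∀ u v → adj u v ≡ adj v u
    irrefl : ∀ v → adj v v ≡ false
open Graph public

degree : ∀ {n} → Graph n → Fin n → ℕ
degree {n} G v = sum (map (λ u → if adj G v u then 1 else 0) (allFin n))

-- maximum degree Δ(G)  (0 for the empty graph)
maxDegree : ∀ {n} → Graph n → ℕ
maxDegree {n} G = foldr _⊔_ 0 (map (degree G) (allFin n))

-- Edges of G: unordered pairs {u,v}, represented once as (u,v) with u < v.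
Edge : ∀ {n} → Graph n → Set
Edge {n} G = Σ (Fin n × Fin n) λ p → (toℕ (proj₁ p) < toℕ (proj₂ p)) × T (adj G (proj₁ p) (proj₂ p))

-- Vertex set of the edge corona G ⋄ H: the vertices of G, plus for each edge e
-- of G a copy H_e of H (vertex (e , x) is vertex x of the copy H_e).
CoronaV : ∀ {n₁} → Graph n₁ → ℕ → Set
CoronaV {n₁} G n₂ = Fin n₁ ⊎ (Edge G × Fin n₂)

CoronaAdj : ∀ {n₁ n₂} (G : Graph n₁) (H : Graph n₂) → CoronaV G n₂ → CoronaV G n₂ → Set
CoronaAdj G H (inj₁ u) (inj₁ v) = T (adj G u v)
CoronaAdj G H (inj₁ u) (inj₂ (e , x)) = (u ≡ proj₁ (proj₁ e)) ⊎ (u ≡ proj₂ (proj₁ e))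
CoronaAdj G H (inj₂ (e , x)) (inj₁ u) = (u ≡ proj₁ (proj₁ e)) ⊎ (u ≡ proj₂ (proj₁ e))
CoronaAdj G H (inj₂ (e , x)) (inj₂ (f , y)) = (e ≡ f) × T (adj H x y)

data WithinDist {V : Set} (Adj : V → V → Set) : ℕ → V → V → Set where
  here : ∀ {k v} → WithinDist Adj k v v
  step : ∀ {k u w v} → Adj u w → WithinDist Adj k w v → WithinDist Adj (suc k) u v

IsDistColoring : {V : Set} (Adj : V → V → Set) (k c : ℕ) → (V → Fin c) → Set
IsDistColoring {V} Adj k c col =
  ∀ (u v : V) → u ≢ v → WithinDist Adj k u v → col u ≢ col v

HasDistColoring : {V : Set} (Adj : V → V → Set) (k c : ℕ) → Set
HasDistColoring {V} Adj k c = Σ (V → Fin c) (IsDistColoring Adj k c)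

IsDistChromaticNumber : {V : Set} (Adj : V → V → Set) (k χ : ℕ) → Set
IsDistChromaticNumber Adj k χ =
  HasDistColoring Adj k χ × (∀ c → HasDistColoring Adj k c → χ ≤ c)

module Submission where

open import Defs
open import Data.Nat using (ℕ; suc; _+_; _*_; _≤_)
open import Data.Product using (_×_)

open import Data.Nat using (_<_; _%_; NonZero; z≤n; s≤s; _≤?_)
import Data.Nat.Properties as ℕ
open import Data.Nat.DivMod using (_mod_; m<n⇒m%n≡m; [m+kn]%n≡m%n; %-distribˡ-+; m%n%n≡m%n)
open import Data.Nat.Tactic.RingSolver using (solve-∀)
open import Data.Fin using (Fin; toℕ; combine; join)
import Data.Fin as Fin
open import Data.Fin.Properties using (toℕ-injective; toℕ<n; toℕ-fromℕ<; <-cmp; pigeonhole; combine-injective; splitAt-join)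
open import Data.Bool using (Bool; true; false; T; if_then_else_)
open import Data.Bool.Properties using (T-irrelevant)
open import Data.Unit using (tt)
open import Data.List using (List; []; _∷_; _++_; map; allFin; length; lookup; cartesianProduct)
open import Data.Nat.ListAction using (sum)
open import Data.List.Properties using (length-map; length-++; length-tabulate; foldr-preservesᵇ)
open import Data.List.Extrema ℕ.≤-totalOrder using (argmax; f[xs]≤f[argmax])
open import Data.List.Membership.Propositional.Properties using (∈-lookup)
open import Data.List.Relation.Unary.All as All using (All; []; _∷_)
import Data.List.Relation.Unary.All.Properties as All
open import Data.List.Relation.Unary.AllPairs as AllPairs using (AllPairs; []; _∷_)
import Data.List.Relation.Unary.AllPairs.Properties as AllPairs
open import Data.List.Relation.Unary.Unique.Propositional using (Unique)
import Data.List.Relation.Unary.Unique.Propositional.Properties as Unique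
open import Data.Product using (Σ; _,_; proj₁; proj₂)
open import Data.Sum using (_⊎_; inj₁; inj₂)
open import Data.Sum.Properties using (inj₁-injective; inj₂-injective)
open import Data.Empty using (⊥-elim)
open import Relation.Nullary using (yes; no)
open import Function using (_∘_)
open import Relation.Binary using (tri<; tri≈; tri>)
import Relation.Binary.PropositionalEquality as ≡
open import Relation.Binary.PropositionalEquality using (_≡_; _≢_; refl; trans; cong; cong₂; subst; module ≡-Reasoning)

-- Lower bound.  Let v be a vertex of G of maximum degree Δ.  The vertex v, its
-- Δ neighbours u, and the Δ·n₂ vertices of the copies H_{vu} are all adjacent
-- to v, so any two of them are at distance at most 2.  A 2-distance colouring
-- gives these 1 + Δ(n₂+1) distinct vertices distinct colours.
--
-- Upper bound.  Give the edge {a,b} of G the key (a + b) mod n₁.  Two distinct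
-- edges with a common end vertex get distinct keys, and two copies H_e, H_f
-- within distance 2 of each other either coincide or belong to such edges.
-- Hence colouring a vertex u of G by (u, ∗) and vertex x of H_e by (key e, x)
-- is a 2-distance colouring with n₁ · (n₂ + 1) colours.

allPairs-lookup : ∀ {A : Set} {R : A → A → Set} {xs : List A} → AllPairs R xs →
                  (i j : Fin (length xs)) → toℕ i < toℕ j → R (lookup xs i) (lookup xs j)
allPairs-lookup (r ∷ _)  Fin.zero    (Fin.suc j) _           = All.lookup r (∈-lookup j)
allPairs-lookup (_ ∷ rs) (Fin.suc i) (Fin.suc j) (s≤s i<j) = allPairs-lookup rs i j i<j

distinct-length≤ : ∀ {c} (zs : List (Fin c)) → AllPairs _≢_ zs → length zs ≤ c
distinct-length≤ {c} zs distinct with length zs ≤? c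
... | yes ≤c = ≤c
... | no ≰c with pigeonhole (ℕ.≰⇒> ≰c) (lookup zs)
...   | i , j , i<j , same = ⊥-elim (allPairs-lookup distinct i j i<j same)

clique-bound : ∀ {V : Set} {Adj : V → V → Set} {k c} {col : V → Fin c} →
               IsDistColoring Adj k c col → (xs : List V) →
               Unique xs → AllPairs (WithinDist Adj k) xs → length xs ≤ c
clique-bound {col = col} isCol xs distinct close = begin
  length xs           ≡⟨ length-map col xs ⟨
  length (map col xs) ≤⟨ distinct-length≤ (map col xs) colours-distinct ⟩
  _                   ∎
  where
  open ℕ.≤-Reasoning
  colours-distinct : AllPairs _≢_ (map col xs)
  colours-distinct = AllPairs.map⁺ (AllPairs.zipWith (λ (u≢v , near) → isCol _ _ u≢v near) (distinct , close))

allPairs-from-all : ∀ {A : Set} {P : A → Set} {R : A → A → Set} →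
                    (∀ {x y} → P x → P y → R x y) → ∀ {xs} → All P xs → AllPairs R xs
allPairs-from-all related []         = []
allPairs-from-all related (px ∷ pxs) = All.map (related px) pxs ∷ allPairs-from-all related pxs

consIf : ∀ {A : Set} (b : Bool) → (T b → A) → List A → List A
consIf true  y ys = y tt ∷ ys
consIf false y ys = ys

module _ {A : Set} where

  consIf-length : ∀ (b : Bool) {y : T b → A} {ys : List A} →
                  length (consIf b y ys) ≡ (if b then 1 else 0) + length ys
  consIf-length true  = refl
  consIf-length false = refl

  consIf-all : ∀ {P : A → Set} (b : Bool) {y : T b → A} {ys : List A} →
               (∀ t → P (y t)) → All P ys → All P (consIf b y ys)
  consIf-all true  py pys = py tt ∷ pys
  consIf-all false py pys = pys

  consIf-allPairs : ∀ {R : A → A → Set} (b : Bool) {y : T b → A} {ys : List A} →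
                    (∀ t → All (R (y t)) ys) → AllPairs R ys → AllPairs R (consIf b y ys)
  consIf-allPairs true  ry rys = ry tt ∷ rys
  consIf-allPairs false ry rys = rys

witnesses : ∀ {A : Set} (b : A → Bool) → List A → List (Σ A (λ x → T (b x)))
witnesses b []       = []
witnesses b (x ∷ xs) = consIf (b x) (x ,_) (witnesses b xs)

witnesses-length : ∀ {A : Set} (b : A → Bool) (xs : List A) →
                   length (witnesses b xs) ≡ sum (map (λ x → if b x then 1 else 0) xs)
witnesses-length b []       = refl
witnesses-length b (x ∷ xs) =
  trans (consIf-length (b x)) (cong ((if b x then 1 else 0) +_) (witnesses-length b xs))

witnesses-all : ∀ {A : Set} {P : A → Set} (b : A → Bool) {xs : List A} →
                All P xs → All (λ w → P (proj₁ w)) (witnesses b xs)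
witnesses-all b []         = []
witnesses-all b {x ∷ _} (px ∷ pxs) = consIf-all (b x) (λ _ → px) (witnesses-all b pxs)

witnesses-unique : ∀ {A : Set} (b : A → Bool) {xs : List A} → Unique xs → Unique (witnesses b xs)
witnesses-unique b []                         = []
witnesses-unique b {x ∷ _} (x∉xs ∷ distinct) = consIf-allPairs (b x)
  (λ _ → All.map (λ x≢y same → x≢y (cong proj₁ same)) (witnesses-all b x∉xs))
  (witnesses-unique b distinct)

length-cartesianProduct : ∀ {A B : Set} (xs : List A) (ys : List B) →
                          length (cartesianProduct xs ys) ≡ length xs * length ys
length-cartesianProduct []       ys = refl
length-cartesianProduct (x ∷ xs) ys = begin
  length (map (x ,_) ys ++ cartesianProduct xs ys)          ≡⟨ length-++ (map (x ,_) ys) ⟩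
  length (map (x ,_) ys) + length (cartesianProduct xs ys)  ≡⟨ cong₂ _+_ (length-map (x ,_) ys) (length-cartesianProduct xs ys) ⟩
  length ys + length xs * length ys                         ∎
  where open ≡-Reasoning

maxDegree-attained : ∀ {m} (G : Graph (suc m)) → Σ (Fin (suc m)) λ v → maxDegree G ≤ degree G v
maxDegree-attained {m} G = v , foldr-preservesᵇ {P = _≤ degree G v} ℕ.⊔-lub z≤n (All.map⁺ degrees≤)
  where
  vertices : List (Fin (suc m))
  vertices = allFin (suc m)
  v : Fin (suc m)
  v = argmax (degree G) Fin.zero vertices
  degrees≤ : All (λ u → degree G u ≤ degree G v) vertices
  degrees≤ = f[xs]≤f[argmax] {f = degree G} Fin.zero vertices

module Edges {n : ℕ} (G : Graph n) where

  lo hi : Edge G → Fin n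
  lo e = proj₁ (proj₁ e)
  hi e = proj₂ (proj₁ e)

  Incident : Fin n → Edge G → Set
  Incident u e = (u ≡ lo e) ⊎ (u ≡ hi e)

  Joins : Fin n → Fin n → Edge G → Set
  Joins v u e = (v ≡ lo e × u ≡ hi e) ⊎ (u ≡ lo e × v ≡ hi e)

  -- An edge is determined by its end vertices (the proofs are irrelevant).
  edge-≡ : {e f : Edge G} → lo e ≡ lo f → hi e ≡ hi f → e ≡ f
  edge-≡ {(_ , lt , t)} {(_ , lt′ , t′)} refl refl =
    cong (_ ,_) (cong₂ _,_ (ℕ.<-irrelevant lt lt′) (T-irrelevant t t′))

  lo≢hi : (e : Edge G) → lo e ≢ hi e
  lo≢hi (_ , lt , _) same = ℕ.<-irrefl (cong toℕ same) lt

  edge-between : (v u : Fin n) → T (adj G v u) → Σ (Edge G) (Joins v u)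
  edge-between v u vu with <-cmp v u
  ... | tri< v<u _ _ = ((v , u) , v<u , vu) , inj₁ (refl , refl)
  ... | tri≈ _ refl _ = ⊥-elim (subst T (irrefl G v) vu)
  ... | tri> _ _ u<v = ((u , v) , u<v , subst T (Graph.sym G v u) vu) , inj₂ (refl , refl)

  joins-incident : ∀ {v u} (e : Edge G) → Joins v u e → Incident v e
  joins-incident _ (inj₁ (v≡lo , _)) = inj₁ v≡lo
  joins-incident _ (inj₂ (_ , v≡hi)) = inj₂ v≡hi

  joins-unique : ∀ {v u w} (e : Edge G) → Joins v u e → Joins v w e → u ≡ w
  joins-unique e (inj₁ (_ , u≡hi))   (inj₁ (_ , w≡hi))   = trans u≡hi (≡.sym w≡hi)
  joins-unique e (inj₁ (v≡lo , _))   (inj₂ (_ , v≡hi))   = ⊥-elim (lo≢hi e (trans (≡.sym v≡lo) v≡hi))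
  joins-unique e (inj₂ (_ , v≡hi))   (inj₁ (v≡lo , _))   = ⊥-elim (lo≢hi e (trans (≡.sym v≡lo) v≡hi))
  joins-unique e (inj₂ (u≡lo , _))   (inj₂ (w≡lo , _))   = trans u≡lo (≡.sym w≡lo)

-- The star of a vertex v of G inside G ⋄ H: v, its neighbours, and the copies
-- of H on edges at v; these vertices are pairwise within distance 2.
module Star {n₁ n₂ : ℕ} (G : Graph n₁) (H : Graph n₂) (v : Fin n₁) where

  open Edges G

  Corona : CoronaV G n₂ → CoronaV G n₂ → Set
  Corona = CoronaAdj G H

  Neighbour : Set
  Neighbour = Σ (Fin n₁) λ u → T (adj G v u)

  neighbours : List Neighbour
  neighbours = witnesses (adj G v) (allFin n₁)

  leaf : Neighbour × Fin (suc n₂) → CoronaV G n₂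
  leaf ((u , _)  , Fin.zero)  = inj₁ u
  leaf ((u , vu) , Fin.suc x) = inj₂ (proj₁ (edge-between v u vu) , x)

  -- Adjacency proofs are irrelevant, so leaves are equal when their vertices are.
  neighbour-≡ : ∀ {u w} {vu : T (adj G v u)} {vw : T (adj G v w)} {i j : Fin (suc n₂)} →
                u ≡ w → i ≡ j → ((u , vu) , i) ≡ ((w , vw) , j)
  neighbour-≡ {vu = vu} {vw} refl refl = cong (λ p → ((_ , p) , _)) (T-irrelevant vu vw)

  -- Distinct leaves are distinct vertices: the copy H_{vu} determines u.
  leaf-injective : ∀ {a b} → leaf a ≡ leaf b → a ≡ b
  leaf-injective {(_ , Fin.zero)}  {(_ , Fin.zero)}  same = neighbour-≡ (inj₁-injective same) refl
  leaf-injective {(_ , Fin.zero)}  {(_ , Fin.suc _)} ()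
  leaf-injective {(_ , Fin.suc _)} {(_ , Fin.zero)}  ()
  leaf-injective {((u , vu) , Fin.suc _)} {((w , vw) , Fin.suc _)} same =
    neighbour-≡ (joins-unique e (proj₂ (edge-between v u vu)) joins-w) (cong Fin.suc (cong proj₂ (inj₂-injective same)))
    where
    e : Edge G
    e = proj₁ (edge-between v u vu)
    joins-w : Joins v w e
    joins-w = subst (Joins v w) (≡.sym (cong proj₁ (inj₂-injective same))) (proj₂ (edge-between v w vw))

  Near : CoronaV G n₂ → Set
  Near z = (z ≡ inj₁ v) ⊎ (Corona z (inj₁ v) × Corona (inj₁ v) z)

  near-close : ∀ {z w} → Near z → Near w → WithinDist Corona 2 z w
  near-close (inj₁ refl)       (inj₁ refl)       = here
  near-close (inj₁ refl)       (inj₂ (_ , vw))   = step vw here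
  near-close (inj₂ (zv , _))   (inj₁ refl)       = step zv here
  near-close (inj₂ (zv , _))   (inj₂ (_ , vw))   = step zv (step vw here)

  -- Every leaf is a neighbour of v; v lies on the edge vu defining H_{vu}.
  leaf-near : ∀ a → Near (leaf a)
  leaf-near ((u , vu) , Fin.zero)  = inj₂ (subst T (Graph.sym G v u) vu , vu)
  leaf-near ((u , vu) , Fin.suc x) = inj₂ (v-incident , v-incident)
    where
    v-incident : Incident v (proj₁ (edge-between v u vu))
    v-incident = joins-incident {u = u} (proj₁ (edge-between v u vu)) (proj₂ (edge-between v u vu))

  -- v itself is not a leaf, as G has no loops.
  v≢leaf : ∀ a → inj₁ v ≢ leaf a
  v≢leaf ((u , vu) , Fin.zero) same = subst T (irrefl G v) (subst (λ w → T (adj G v w)) (≡.sym (inj₁-injective same)) vu)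
  v≢leaf ((u , vu) , Fin.suc x) ()

  star : List (CoronaV G n₂)
  star = inj₁ v ∷ map leaf (cartesianProduct neighbours (allFin (suc n₂)))

  star-unique : Unique star
  star-unique = All.map⁺ (All.universal v≢leaf _)
              ∷ Unique.map⁺ leaf-injective
                  (Unique.cartesianProduct⁺ (witnesses-unique (adj G v) (Unique.allFin⁺ n₁)) (Unique.allFin⁺ (suc n₂)))

  star-close : AllPairs (WithinDist Corona 2) star
  star-close = allPairs-from-all near-close (inj₁ refl ∷ All.map⁺ (All.universal leaf-near _))

  star-length : length star ≡ (n₂ + 1) * degree G v + 1
  star-length = begin
    suc (length (map leaf (cartesianProduct neighbours (allFin (suc n₂)))))
      ≡⟨ cong suc (length-map leaf (cartesianProduct neighbours (allFin (suc n₂)))) ⟩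
    suc (length (cartesianProduct neighbours (allFin (suc n₂))))
      ≡⟨ cong suc (length-cartesianProduct neighbours (allFin (suc n₂))) ⟩
    suc (length neighbours * length (allFin (suc n₂)))
      ≡⟨ cong suc (cong₂ _*_ (witnesses-length (adj G v) (allFin n₁)) (length-tabulate {n = suc n₂} (λ i → i))) ⟩
    suc (degree G v * suc n₂)
      ≡⟨ reorder (degree G v) n₂ ⟩
    (n₂ + 1) * degree G v + 1 ∎
    where
    open ≡-Reasoning
    reorder : ∀ d n → suc (d * suc n) ≡ (n + 1) * d + 1
    reorder = solve-∀

lower-bound : ∀ {n₁ n₂ c} (G : Graph n₁) (H : Graph n₂) {col : CoronaV G n₂ → Fin c} →
              IsDistColoring (CoronaAdj G H) 2 c col → (v : Fin n₁) → (n₂ + 1) * degree G v + 1 ≤ c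
lower-bound G H isCol v = ℕ.≤-trans (ℕ.≤-reflexive (≡.sym star-length)) (clique-bound isCol star star-unique star-close)
  where open Star G H v

%-absorbˡ : ∀ x y n .{{_ : NonZero n}} → (x % n + y) % n ≡ (x + y) % n
%-absorbˡ x y n = begin
  (x % n + y) % n          ≡⟨ %-distribˡ-+ (x % n) y n ⟩
  (x % n % n + y % n) % n  ≡⟨ cong (λ r → (r + y % n) % n) (m%n%n≡m%n x n) ⟩
  (x % n + y % n) % n      ≡⟨ %-distribˡ-+ x y n ⟨
  (x + y) % n              ∎
  where open ≡-Reasoning

-- Adding a fixed a modulo suc m is injective on 0 … m: the translate by a is
-- undone by adding a · m, since a + a · m ≡ 0 modulo suc m.
+-mod-cancelˡ : ∀ {m} a {b c} → b < suc m → c < suc m →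
                (a + b) % suc m ≡ (a + c) % suc m → b ≡ c
+-mod-cancelˡ {m} a {b} {c} b<n c<n same = begin
  b                               ≡⟨ undo b b<n ⟩
  ((a + b) % suc m + a * m) % suc m ≡⟨ cong (λ r → (r + a * m) % suc m) same ⟩
  ((a + c) % suc m + a * m) % suc m ≡⟨ undo c c<n ⟨
  c                               ∎
  where
  open ≡-Reasoning
  regroup : ∀ a z k → z + a * suc k ≡ (a + z) + a * k
  regroup = solve-∀
  undo : ∀ z → z < suc m → z ≡ ((a + z) % suc m + a * m) % suc m
  undo z z<n = begin
    z                             ≡⟨ m<n⇒m%n≡m z<n ⟨
    z % suc m                     ≡⟨ [m+kn]%n≡m%n z a (suc m) ⟨
    (z + a * suc m) % suc m       ≡⟨ cong (_% suc m) (regroup a z m) ⟩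
    ((a + z) + a * m) % suc m     ≡⟨ %-absorbˡ (a + z) (a * m) (suc m) ⟨
    ((a + z) % suc m + a * m) % suc m ∎

encode : ∀ {p q r} → Fin p × (Fin q ⊎ Fin r) → Fin (p * (q + r))
encode {q = q} {r} (i , s) = combine i (join q r s)

encode-injective : ∀ {p q r} {a b : Fin p × (Fin q ⊎ Fin r)} → encode a ≡ encode b → a ≡ b
encode-injective {q = q} {r} {i , s} {j , t} same with combine-injective i _ j _ same
... | i≡j , joins≡ = cong₂ _,_ i≡j (begin
  s                               ≡⟨ splitAt-join q r s ⟨
  Fin.splitAt q (join q r s)      ≡⟨ cong (Fin.splitAt q) joins≡ ⟩
  Fin.splitAt q (join q r t)      ≡⟨ splitAt-join q r t ⟩
  t                               ∎)
  where open ≡-Reasoning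

module KeyColouring {m n₂ : ℕ} (G : Graph (suc m)) (H : Graph n₂) where

  open Edges G

  Corona : CoronaV G n₂ → CoronaV G n₂ → Set
  Corona = CoronaAdj G H

  key : Edge G → Fin (suc m)
  key e = (toℕ (lo e) + toℕ (hi e)) mod suc m

  key-cancel : ∀ (u x y : Fin (suc m)) →
               (toℕ u + toℕ x) % suc m ≡ (toℕ u + toℕ y) % suc m → x ≡ y
  key-cancel u x y same = toℕ-injective (+-mod-cancelˡ (toℕ u) (toℕ<n x) (toℕ<n y) same)

  swap : ∀ (x y : Fin (suc m)) → (toℕ x + toℕ y) % suc m ≡ (toℕ y + toℕ x) % suc m
  swap x y = cong (_% suc m) (ℕ.+-comm (toℕ x) (toℕ y))

  key-% : ∀ e f → key e ≡ key f →
          (toℕ (lo e) + toℕ (hi e)) % suc m ≡ (toℕ (lo f) + toℕ (hi f)) % suc m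
  key-% _ _ same = trans (≡.sym (toℕ-fromℕ< _)) (trans (cong toℕ same) (toℕ-fromℕ< _))

  -- Two edges through a common vertex u with equal keys are equal.  If u were the
  -- smaller end of one and the larger end of the other, their other ends would
  -- coincide, contradicting lo < hi.
  key-injective : ∀ {u} (e f : Edge G) → Incident u e → Incident u f → key e ≡ key f → e ≡ f
  key-injective e@((u , b) , _) f@((_ , b′) , _) (inj₁ refl) (inj₁ refl) same =
    edge-≡ refl (key-cancel u b b′ (key-% e f same))
  key-injective e@((a , u) , _) f@((a′ , _) , _) (inj₂ refl) (inj₂ refl) same =
    edge-≡ (key-cancel u a a′ (trans (swap u a) (trans (key-% e f same) (swap a′ u)))) refl
  key-injective e@((u , b) , u<b , _) f@((a′ , _) , a′<u , _) (inj₁ refl) (inj₂ refl) same =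
    ⊥-elim (ℕ.<-asym u<b (subst (λ w → toℕ w < toℕ u) (≡.sym b≡a′) a′<u))
    where
    b≡a′ : b ≡ a′
    b≡a′ = key-cancel u b a′ (trans (key-% e f same) (swap a′ u))
  key-injective e@((a , u) , a<u , _) f@((_ , b′) , u<b′ , _) (inj₂ refl) (inj₁ refl) same =
    ⊥-elim (ℕ.<-asym u<b′ (subst (λ w → toℕ w < toℕ u) a≡b′ a<u))
    where
    a≡b′ : a ≡ b′
    a≡b′ = key-cancel u a b′ (trans (swap u a) (key-% e f same))

  -- Copies H_e, H_f within distance 2 whose edges have equal keys coincide: a
  -- path of length ≤ 2 between them stays in one copy or passes through a common
  -- end vertex of e and f.
  copies-close : ∀ {e f x y} → key e ≡ key f → WithinDist Corona 2 (inj₂ (e , x)) (inj₂ (f , y)) → e ≡ f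
  copies-close same here                                         = refl
  copies-close same (step (e≡f , _) here)                         = e≡f
  copies-close {e} {f} same (step {w = inj₁ u} ue (step uf here)) = key-injective e f ue uf same
  copies-close same (step {w = inj₂ _} (e≡g , _) (step (g≡f , _) here)) = trans e≡g g≡f

  precolour : CoronaV G n₂ → Fin (suc m) × (Fin n₂ ⊎ Fin 1)
  precolour (inj₁ u)       = u , inj₂ Fin.zero
  precolour (inj₂ (e , x)) = key e , inj₁ x

  precolour-valid : ∀ z w → z ≢ w → WithinDist Corona 2 z w → precolour z ≢ precolour w
  precolour-valid (inj₁ u) (inj₁ w) z≢w _ same = z≢w (cong inj₁ (cong proj₁ same))
  precolour-valid (inj₁ _) (inj₂ _) _ _ same with cong proj₂ same
  ... | ()
  precolour-valid (inj₂ _) (inj₁ _) _ _ same with cong proj₂ same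
  ... | ()
  precolour-valid (inj₂ (e , x)) (inj₂ (f , y)) z≢w close same =
    z≢w (cong₂ (λ g v → inj₂ (g , v)) (copies-close (cong proj₁ same) close) (inj₁-injective (cong proj₂ same)))

  colouring : HasDistColoring Corona 2 (suc m * (n₂ + 1))
  colouring = encode ∘ precolour , λ z w z≢w close same → precolour-valid z w z≢w close (encode-injective same)

mainTheorem7 : ∀ {n₁ n₂ : ℕ} (G : Graph n₁) (H : Graph n₂) → 1 ≤ n₁ → (χ : ℕ) → IsDistChromaticNumber (CoronaAdj G H) 2 χ → ((n₂ + 1) * maxDegree G + 1 ≤ χ) × (χ ≤ n₁ * (n₂ + 1))
mainTheorem7 {suc m} {n₂} G H (s≤s z≤n) χ ((col , isCol) , minimal) = lower , upper
  where
  v : Fin (suc m)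
  v = proj₁ (maxDegree-attained G)
  Δ≤deg : maxDegree G ≤ degree G v
  Δ≤deg = proj₂ (maxDegree-attained G)
  lower : (n₂ + 1) * maxDegree G + 1 ≤ χ
  lower = ℕ.≤-trans (ℕ.+-monoˡ-≤ 1 (ℕ.*-monoʳ-≤ (n₂ + 1) Δ≤deg)) (lower-bound G H isCol v)
  upper : χ ≤ suc m * (n₂ + 1)
  upper = minimal (suc m * (n₂ + 1)) (KeyColouring.colouring G H)
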